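{- Let $(\Phi,\mathfrak N,\mathfrak T,\mathfrak R,\mathfrak S,\phi_{\mathrm{start}},\Sigma,\mathrm{Lex},\mathrm{Sel})$ be a parameterized local lexing, $D\in\Sigma^*$, $0\le k\le|D|$, $T$ a set of parameterized tokens, $I$ a set of parameterized items and $I'$ a set of ordinary items of the induced grammar. If $I\sim I'$, then $\mathrm{Scan}\,T\,k\,I\sim\mathrm{Scan}'\,\mathcal U(T)\,k\,I'$.
   Context: $\Phi$ is a non-empty set; $\mathfrak N,\mathfrak T$ disjoint sets of nonterminals and terminals; $\mathfrak S\in\mathfrak N$, $\phi_{\mathrm{start}}\in\Phi$; $\mathfrak R$ a set of parameterized rules $N_{f_{k+1}}\to X_1^{f_1}\cdots X_k^{f_k}$ ($k\ge0$, $N\in\mathfrak N$, $X_i\in\mathfrak N\cup\mathfrak T$, partial $f_i:\Phi^{2i-1}\rightharpoonup\Phi$); $\Sigma$ a set of characters; $\mathrm{Lex},\mathrm{Sel}$ not needed here. A parameterized token is an element $(t,\alpha,\beta,c)$ of $\mathfrak T\times\Phi\times\Phi\times\Sigma^*$ with $k+|c|\le|D|$ whenever it is used at position $k$ (as produced by the lexer). Sequences indexed from 0; juxtaposition is concatenation; $\mathrm{take}_n$ takes the first $n$ entries. $\langle f_1,\dots,f_u\rangle$ is the set of $\rho\in\Phi^{2u}$ with $f_i$ defined at $(\rho_0,\dots,\rho_{2i-2})$ and $\rho_{2i-1}=f_i(\rho_0,\dots,\rho_{2i-2})$ for $i=1,\dots,u$. Induced grammar: nonterminals $(\mathfrak N\times\Phi\times\Phi)\cup\{\top,\bot\}$,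 terminals $\overline{\mathfrak T}=\mathfrak T\times\Phi\times\Phi$, triples written $X^\alpha_\beta$; rules $\overline{\mathfrak R}=\{\top\to\mathfrak S^{\phi_{\mathrm{start}}}_\beta\mid\beta\in\Phi\}\cup\bigcup_{r\in\mathfrak R}\overline r$, where for $r=N_{f_{k+1}}\to X_1^{f_1}\cdots X_k^{f_k}$, $\overline r$ consists of (i) rules $N^\alpha_\beta\to(X_1)^{\alpha_1}_{\beta_1}\cdots(X_k)^{\alpha_k}_{\beta_k}$ with $(\alpha,\alpha_1,\beta_1,\dots,\alpha_k,\beta_k,\beta)\in\langle f_1,\dots,f_{k+1}\rangle$, and (ii) rules $N^\alpha_\beta\to(X_1)^{\alpha_1}_{\beta_1}\cdots(X_h)^{\alpha_h}_{\beta_h}\bot$ with $1\le h\le k$, $\beta,\beta_h\in\Phi$, $(\alpha,\alpha_1,\beta_1,\dots,\alpha_h)\in\langle f_1,\dots,f_h\rangle$ and $f_{h+1}$ undefined at $(\alpha,\alpha_1,\beta_1,\dots,\alpha_h,\beta_h)$. $\mathcal U(t,\alpha,\beta,c)=(t^\alpha_\beta,c)$, lifted to sets. Items: parameterized item $(r,d,i,j,\rho)$ with $r=N_{f_{v+1}}\to X_1^{f_1}\cdots X_v^{f_v}\in\mathfrak R$, $0\le d\le v$, $0\le i\le j\le|D|$, $\rho\in\langle f_1,\dots,f_{d+1}\rangle$. Ordinary item $(q,d,i,j)$ with $q=(L\to w)\in\overline{\mathfrak R}$, $0\le d\le|w|$, $0\le i\le j\le|D|$, written $(L\to w_1\bullet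 w_2,i,j)$, $|w_1|=d$. For $x=(r,d,i,j,\rho)$, $\overline x$ consists of all $(q,d,i,j)$ with $q\in\overline r$ of type (i) and $\mathrm{take}_{2(d+1)}(\alpha,\alpha_1,\beta_1,\dots,\alpha_k,\beta_k,\beta)=\rho$, and all $(q,d,i,j)$ with $q\in\overline r$ of type (ii), $d\le h-1$, $\mathrm{take}_{2(d+1)}(\alpha,\alpha_1,\beta_1,\dots,\alpha_h)=\rho$. $\overline I=\bigcup_{x\in I}\overline x$; $\mathrm{Norm}(I')=\{(L\to w_1\bullet w_2,i,j)\in I'\mid L\ne\top,\ w_2\text{ is not the one-symbol string }\bot\}$; $I\sim I'$ means $\overline I=\mathrm{Norm}(I')$. $\mathrm{Scan}\,T\,k\,I=I\cup\{(r,d+1,i,k+|c|,\rho'\,f_{d+2}(\rho'))\mid(r,d,i,k,\rho)\in I,\ r=N_{f_{v+1}}\to X_1^{f_1}\cdots X_v^{f_v},\ d<v,\ (X_{d+1},\rho_{2d+1},\beta,c)\in T,\ \rho'=\rho\,\beta,\ f_{d+2}\text{ defined at }\rho'\}$. $\mathrm{Scan}'\,T'\,k\,I'=I'\cup\{(L\to a\,t\bullet b,i,k+|c|)\mid(L\to a\bullet t\,b,i,k)\in I',\ (t,c)\in T'\}$. -}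

module Defs where

open import Data.Nat using (ℕ; zero; suc; _+_; _*_; _∸_; _≤_; _<_; _<?_; _≟_)
open import Data.Fin using (Fin; toℕ; fromℕ<)
open import Data.Fin.Properties using (toℕ-fromℕ<)
open import Data.List using (List; []; _∷_; _++_; length; take; drop)
open import Data.Vec using (Vec; fromList)
open import Data.Maybe using (Maybe; just; nothing)
open import Data.Product using (Σ; ∃; _×_; _,_)
open import Data.Sum using (_⊎_; inj₁; inj₂)
open import Relation.Nullary using (¬_; yes; no)
open import Relation.Binary.PropositionalEquality using (_≡_; _≢_; subst; sym)

at : {A : Set} → List A → ℕ → Maybe A
at []       _       = nothing
at (x ∷ _)  zero    = just x
at (_ ∷ xs) (suc n) = at xs n

-- Everything below is relative to the data Φ, 𝔑, 𝔗, Σ of a parameterized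
-- local lexing (Lex and Sel are not needed).
module Grammar (Φ 𝔑 𝔗 Σ : Set) where

  Sym : Set
  Sym = 𝔑 ⊎ 𝔗

  -- A parameterized rule  N_{f_{k+1}} → X_1^{f_1} ⋯ X_k^{f_k}.
  -- fs i  is the partial function  f_{i+1} : Φ^{2(i+1)-1} ⇀ Φ  (i = 0,…,k),
  -- partiality encoded by Maybe.
  record Rule : Set where
    field
      lhs : 𝔑
      rhs : List Sym
      fs  : (i : Fin (suc (length rhs))) → Vec Φ (suc (2 * toℕ i)) → Maybe Φ
  open Rule public

  -- f r i ρ  =  f_i(ρ)  (1-based, as in the paper), applied to a tuple given
  -- as a list; "nothing" if i is out of range 1..k+1 or ρ has the wrong length
  -- (never used in those cases).
  f : Rule → ℕ → List Φ → Maybe Φ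
  f r zero    ρ = nothing
  f r (suc i) ρ with i <? suc (length (rhs r)) | length ρ ≟ suc (2 * i)
  ... | yes p | yes eq =
        fs r (fromℕ< p)
          (subst (λ m → Vec Φ (suc (2 * m))) (sym (toℕ-fromℕ< p))
                 (subst (Vec Φ) eq (fromList ρ)))
  ... | _ | _ = nothing

  InAngle : Rule → ℕ → List Φ → Set
  InAngle r u ρ =
    length ρ ≡ 2 * u ×
    ((i : ℕ) → i < u →
       ∃ λ x → at ρ (suc (2 * i)) ≡ just x × f r (suc i) (take (suc (2 * i)) ρ) ≡ just x)

  record PToken : Set where
    constructor ptok
    field
      tok   : 𝔗
      alpha : Φ
      beta  : Φ
      chars : List Σ
  open PToken public

  data NTbar : Set where
    nt  : 𝔑 → Φ → Φ → NTbar
    top : NTbar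
    bot : NTbar

  Tbar : Set
  Tbar = 𝔗 × Φ × Φ

  Symbar : Set
  Symbar = NTbar ⊎ Tbar

  liftSym : Sym → Φ → Φ → Symbar
  liftSym (inj₁ n) a b = inj₁ (nt n a b)
  liftSym (inj₂ t) a b = inj₂ (t , a , b)

  liftRhs : List Sym → List Φ → List Symbar
  liftRhs (X ∷ Xs) (a ∷ b ∷ ρ) = liftSym X a b ∷ liftRhs Xs ρ
  liftRhs _        _           = []

  -- type (i) rules of r̄:  N^α_β → (X_1)^{α_1}_{β_1} ⋯ (X_k)^{α_k}_{β_k},
  -- with mid = (α_1,β_1,…,α_k,β_k);  the key tuple is α ∷ mid ++ [β].
  TyI : Rule → NTbar → List Symbar → Φ → List Φ → Φ → Set
  TyI r L w α mid β =
    InAngle r (suc (length (rhs r))) (α ∷ mid ++ β ∷ []) ×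
    L ≡ nt (lhs r) α β ×
    w ≡ liftRhs (rhs r) mid

  -- type (ii) rules of r̄:  N^α_β → (X_1)^{α_1}_{β_1} ⋯ (X_h)^{α_h}_{β_h} ⊥,
  -- with mid = (α_1,β_1,…,β_{h-1},α_h); the key tuple is α ∷ mid.
  TyII : Rule → NTbar → List Symbar → ℕ → Φ → List Φ → Φ → Φ → Set
  TyII r L w h α mid βh β =
    1 ≤ h × h ≤ length (rhs r) ×
    InAngle r h (α ∷ mid) ×
    f r (suc h) (α ∷ mid ++ βh ∷ []) ≡ nothing ×
    L ≡ nt (lhs r) α β ×
    w ≡ liftRhs (take h (rhs r)) (mid ++ βh ∷ []) ++ inj₁ bot ∷ []

  record PItem : Set where
    constructor pitem
    field
      prule : Rule
      pd    : ℕ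
      pi    : ℕ
      pj    : ℕ
      pρ    : List Φ
  open PItem public

  record OItem : Set where
    constructor oitem
    field
      olhs : NTbar
      orhs : List Symbar
      od   : ℕ
      oi   : ℕ
      oj   : ℕ
  open OItem public

  module Lexing (ℜ : Rule → Set) (𝔖 : 𝔑) (φstart : Φ) (D : List Σ) where

    RuleBar : NTbar → List Symbar → Set
    RuleBar L w =
      (L ≡ top × ∃ λ β → w ≡ inj₁ (nt 𝔖 φstart β) ∷ [])
      ⊎ (∃ λ r → ℜ r ×
           ((∃ λ α → ∃ λ mid → ∃ λ β → TyI r L w α mid β)
            ⊎ (∃ λ h → ∃ λ α → ∃ λ mid → ∃ λ βh → ∃ λ β → TyII r L w h α mid βh β)))

    ValidPItem : PItem → Set
    ValidPItem (pitem r d i j ρ) =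
      ℜ r × d ≤ length (rhs r) × i ≤ j × j ≤ length D × InAngle r (suc d) ρ

    ValidOItem : OItem → Set
    ValidOItem (oitem L w d i j) =
      RuleBar L w × d ≤ length w × i ≤ j × j ≤ length D

    Bar : PItem → OItem → Set
    Bar (pitem r d i j ρ) (oitem L w d' i' j') =
      d' ≡ d × i' ≡ i × j' ≡ j ×
      ((∃ λ α → ∃ λ mid → ∃ λ β → TyI r L w α mid β ×
          take (2 * suc d) (α ∷ mid ++ β ∷ []) ≡ ρ)
       ⊎ (∃ λ h → ∃ λ α → ∃ λ mid → ∃ λ βh → ∃ λ β → TyII r L w h α mid βh β ×
          d < h × take (2 * suc d) (α ∷ mid) ≡ ρ))

    BarSet : (PItem → Set) → OItem → Set
    BarSet I y = ∃ λ x → I x × Bar x y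

    Norm : (OItem → Set) → OItem → Set
    Norm I' y = I' y × olhs y ≢ top × ¬ (drop (od y) (orhs y) ≡ inj₁ bot ∷ [])

    _∼_ : (PItem → Set) → (OItem → Set) → Set
    I ∼ I' = (y : OItem) → (BarSet I y → Norm I' y) × (Norm I' y → BarSet I y)

    𝒰 : (PToken → Set) → Tbar × List Σ → Set
    𝒰 T (tb , c) = ∃ λ tk → T tk × (tok tk , alpha tk , beta tk) ≡ tb × chars tk ≡ c

    Scan : (PToken → Set) → ℕ → (PItem → Set) → PItem → Set
    Scan T k I x =
      I x ⊎
      (∃ λ r → ∃ λ d → ∃ λ i → ∃ λ ρ → ∃ λ t → ∃ λ α → ∃ λ β → ∃ λ c → ∃ λ φ →
         I (pitem r d i k ρ) ×
         d < length (rhs r) ×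
         at (rhs r) d ≡ just (inj₂ t) ×          -- X_{d+1} = t
         at ρ (suc (2 * d)) ≡ just α ×            -- ρ_{2d+1} = α
         T (ptok t α β c) ×
         f r (suc (suc d)) (ρ ++ β ∷ []) ≡ just φ ×
         x ≡ pitem r (suc d) i (k + length c) (ρ ++ β ∷ φ ∷ []))

    Scan' : (Tbar × List Σ → Set) → ℕ → (OItem → Set) → OItem → Set
    Scan' T' k I' y =
      I' y ⊎
      (∃ λ L → ∃ λ a → ∃ λ t → ∃ λ b → ∃ λ i → ∃ λ c →
         I' (oitem L (a ++ inj₂ t ∷ b) (length a) i k) ×
         T' (t , c) ×
         y ≡ oitem L (a ++ inj₂ t ∷ b) (suc (length a)) i (k + length c))

-- The ordinary items in the image of a parameterized item (r, d, i, j, ρ) are the lifted rules of r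
-- whose parameter tuple κ = (α, α₁, β₁, …) extends ρ, with the dot at d. Symbol d + 1 of a lifted
-- right-hand side carries the parameters κ_{2d+1}, κ_{2d+2}, so scanning a token (t, α, β, c) in
-- Scan (append β and φ = f_{d+2}(ρ β) to ρ) corresponds exactly to scanning the lifted terminal t^α_β
-- in Scan', with φ the next entry κ_{2d+3}. For a type (ii) rule the scanned item is kept by Norm
-- precisely when the scanned symbol is not the one before ⊥, i.e. when d + 1 < h.
module Submission where

open import Defs
open import Data.Nat using (ℕ; zero; suc; _+_; _*_; _≤_; _<_; z≤n; s≤s; s≤s⁻¹)
open import Data.Nat.Properties
  using (suc-injective; 0≢1+n; *-suc; *-monoʳ-≤; n<1+n; <⇒≤; <-trans; <-irrefl; m≤n⇒m⊓n≡m)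
open import Data.List using (List; []; _∷_; _++_; length; take; drop)
open import Data.List.Properties
  using (∷-injective; ∷-injectiveˡ; ∷-injectiveʳ; ∷ʳ-injectiveˡ; ++-assoc; length-take)
open import Data.Maybe using (just)
open import Data.Product using (∃; ∃₂; _×_; _,_; proj₁; proj₂; map₁)
open import Data.Sum using (_⊎_; inj₁; inj₂)
open import Data.Empty using (⊥-elim)
open import Function using (_∘_)
open import Relation.Binary.PropositionalEquality
  using (_≡_; _≢_; refl; sym; trans; cong; subst; module ≡-Reasoning)

odd<double : ∀ {d n} → d < n → suc (2 * d) < 2 * n
odd<double {d} {n} d<n = subst (_≤ 2 * n) (*-suc 2 d) (*-monoʳ-≤ 2 d<n)

module _ {A : Set} where

  at-just⇒< : (xs : List A) (j : ℕ) {v : A} → at xs j ≡ just v → j < length xs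
  at-just⇒< (x ∷ xs) zero    _ = s≤s z≤n
  at-just⇒< (x ∷ xs) (suc j) e = s≤s (at-just⇒< xs j e)

  at-take : (xs : List A) {n j : ℕ} → j < n → at (take n xs) j ≡ at xs j
  at-take []       {suc n}         _       = refl
  at-take (x ∷ xs) {suc n} {zero}  _       = refl
  at-take (x ∷ xs) {suc n} {suc j} (s≤s p) = at-take xs p

  at-prefix : {xs ys : List A} {n j : ℕ} → take n xs ≡ ys → j < n → at ys j ≡ at xs j
  at-prefix {xs} refl j<n = at-take xs j<n

  at-++ˡ : (xs : List A) {ys : List A} {j : ℕ} → j < length xs → at (xs ++ ys) j ≡ at xs j
  at-++ˡ (x ∷ xs) {j = zero}  _       = refl
  at-++ˡ (x ∷ xs) {j = suc j} (s≤s p) = at-++ˡ xs p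

  at-++-just : (xs : List A) {ys : List A} {j : ℕ} {v : A} → at xs j ≡ just v → at (xs ++ ys) j ≡ just v
  at-++-just xs {j = j} e = trans (at-++ˡ xs (at-just⇒< xs j e)) e

  at-∷-∷-even : {x y : A} {xs : List A} (n : ℕ) → at (x ∷ y ∷ xs) (2 * suc n) ≡ at xs (2 * n)
  at-∷-∷-even {x} {y} {xs} n = cong (at (x ∷ y ∷ xs)) (*-suc 2 n)

  at-∷-∷-odd : {x y : A} {xs : List A} (n : ℕ) → at (x ∷ y ∷ xs) (suc (2 * suc n)) ≡ at xs (suc (2 * n))
  at-∷-∷-odd {x} {y} {xs} n = cong (at (x ∷ y ∷ xs) ∘ suc) (*-suc 2 n)

  take≡++∷⇒ : {n : ℕ} {xs : List A} (ys : List A) {z : A} {zs : List A} →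
    take n xs ≡ ys ++ z ∷ zs → take (length ys) xs ≡ ys × at xs (length ys) ≡ just z
  take≡++∷⇒ {suc n} {x ∷ xs} []       refl = refl , refl
  take≡++∷⇒ {suc n} {x ∷ xs} (y ∷ ys) eq with ∷-injective eq
  ... | refl , eq′ with take≡++∷⇒ ys eq′
  ...   | tk , at-z = cong (x ∷_) tk , at-z

  take-suc-at : {n : ℕ} {xs ys : List A} {z : A} →
    take n xs ≡ ys → at xs n ≡ just z → take (suc n) xs ≡ ys ++ z ∷ []
  take-suc-at {zero}  {x ∷ xs} refl refl = refl
  take-suc-at {suc n} {x ∷ xs} refl e    = cong (x ∷_) (take-suc-at refl e)

  drop-++-length : (xs : List A) {ys : List A} → drop (length xs) (xs ++ ys) ≡ ys
  drop-++-length []       = refl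
  drop-++-length (x ∷ xs) = drop-++-length xs

  drop-++-∷ : (xs : List A) {y : A} {ys : List A} → drop (suc (length xs)) (xs ++ y ∷ ys) ≡ ys
  drop-++-∷ []       = refl
  drop-++-∷ (x ∷ xs) = drop-++-∷ xs

  length-∷ʳ : (xs : List A) {y : A} → length (xs ++ y ∷ []) ≡ suc (length xs)
  length-∷ʳ []       = refl
  length-∷ʳ (x ∷ xs) = cong suc (length-∷ʳ xs)

  length-++-∷-∷ : (xs : List A) {y z : A} {zs : List A} → suc (length xs) < length (xs ++ y ∷ z ∷ zs)
  length-++-∷-∷ []       = s≤s (s≤s z≤n)
  length-++-∷-∷ (x ∷ xs) = s≤s (length-++-∷-∷ xs)

  []≢++∷ : (xs : List A) {y : A} {ys : List A} → [] ≢ xs ++ y ∷ ys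
  []≢++∷ []      ()
  []≢++∷ (_ ∷ _) ()

  ++-∷-split : (xs zs as : List A) {y : A} {bs : List A} → xs ++ zs ≡ as ++ y ∷ bs → length as < length xs →
    ∃ λ ys → xs ≡ as ++ y ∷ ys × bs ≡ ys ++ zs
  ++-∷-split (x ∷ xs) zs []       eq _ with ∷-injective eq
  ... | refl , refl = xs , refl , refl
  ++-∷-split (x ∷ xs) zs (a ∷ as) eq (s≤s lt) with ∷-injective eq
  ... | refl , eq′ with ++-∷-split xs zs as eq′ lt
  ...   | ys , refl , bs≡ = ys , refl , bs≡

module _ (Φ 𝔑 𝔗 Σ : Set) where
  open Grammar Φ 𝔑 𝔗 Σ

  liftSym-terminal : (X : Sym) {a b α β : Φ} {t : 𝔗} → inj₂ (t , α , β) ≡ liftSym X a b →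
    X ≡ inj₂ t × a ≡ α × b ≡ β
  liftSym-terminal (inj₂ _) refl = refl , refl , refl

  lookup-liftRhs : (Xs : List Sym) (ms : List Φ) (pre : List Symbar) {s : Symbar} {post : List Symbar} →
    liftRhs Xs ms ≡ pre ++ s ∷ post →
    ∃ λ X → ∃₂ λ a b → at Xs (length pre) ≡ just X × at ms (2 * length pre) ≡ just a ×
      at ms (suc (2 * length pre)) ≡ just b × s ≡ liftSym X a b
  lookup-liftRhs []       _            pre eq = ⊥-elim ([]≢++∷ pre eq)
  lookup-liftRhs (_ ∷ _)  []           pre eq = ⊥-elim ([]≢++∷ pre eq)
  lookup-liftRhs (_ ∷ _)  (_ ∷ [])     pre eq = ⊥-elim ([]≢++∷ pre eq)
  lookup-liftRhs (X ∷ Xs) (a ∷ b ∷ ms) []  eq with ∷-injective eq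
  ... | refl , _ = X , a , b , refl , refl , refl , refl
  lookup-liftRhs (X ∷ Xs) (a ∷ b ∷ ms) (_ ∷ pre) eq with lookup-liftRhs Xs ms pre (∷-injectiveʳ eq)
  ... | X′ , a′ , b′ , at-X , at-a , at-b , s≡ =
    X′ , a′ , b′ , at-X , trans (at-∷-∷-even {x = a} {b} {ms} (length pre)) at-a ,
    trans (at-∷-∷-odd {x = a} {b} {ms} (length pre)) at-b , s≡

  split-liftRhs : (Xs : List Sym) (ms : List Φ) (d : ℕ) {X : Sym} {a b : Φ} →
    at Xs d ≡ just X → at ms (2 * d) ≡ just a → at ms (suc (2 * d)) ≡ just b →
    ∃₂ λ pre post → liftRhs Xs ms ≡ pre ++ liftSym X a b ∷ post × length pre ≡ d
  split-liftRhs (X ∷ Xs)  (a ∷ b ∷ ms)   zero    refl refl refl = [] , liftRhs Xs ms , refl , refl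
  split-liftRhs (X′ ∷ Xs) (a′ ∷ b′ ∷ ms) (suc d) at-X at-a at-b
    with split-liftRhs Xs ms d at-X (trans (sym (at-∷-∷-even {x = a′} {b′} {ms} d)) at-a)
                (trans (sym (at-∷-∷-odd {x = a′} {b′} {ms} d)) at-b)
  ... | pre , post , eq , refl = liftSym X′ a′ b′ ∷ pre , post , cong (_ ∷_) eq , refl

  length-liftRhs : (Xs : List Sym) (ms : List Φ) →
    length ms ≡ 2 * length Xs → length (liftRhs Xs ms) ≡ length Xs
  length-liftRhs []       _            _ = refl
  length-liftRhs (X ∷ Xs) []           ()
  length-liftRhs (X ∷ Xs) (a ∷ [])     e = ⊥-elim (0≢1+n (suc-injective (trans e (*-suc 2 (length Xs)))))
  length-liftRhs (X ∷ Xs) (a ∷ b ∷ ms) e =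
    cong suc (length-liftRhs Xs ms (suc-injective (suc-injective (trans e (*-suc 2 (length Xs))))))

  ⊥∉liftRhs : (Xs : List Sym) (ms : List Φ) (pre : List Symbar) {post : List Symbar} →
    liftRhs Xs ms ≢ pre ++ inj₁ bot ∷ post
  ⊥∉liftRhs Xs ms pre eq with lookup-liftRhs Xs ms pre eq
  ... | inj₁ _ , _ , _ , _ , _ , _ , ()
  ... | inj₂ _ , _ , _ , _ , _ , _ , ()

  Instance : Rule → ℕ → List Φ → NTbar → List Symbar → Set
  Instance r d ρ L w =
    (∃ λ α → ∃ λ mid → ∃ λ β → TyI r L w α mid β × take (2 * suc d) (α ∷ mid ++ β ∷ []) ≡ ρ)
    ⊎ (∃ λ h → ∃ λ α → ∃ λ mid → ∃ λ βh → ∃ λ β → TyII r L w h α mid βh β ×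
         d < h × take (2 * suc d) (α ∷ mid) ≡ ρ)

  key-shrink : {d : ℕ} {κ ρ : List Φ} {α β φ : Φ} →
    length ρ ≡ 2 * suc d → at ρ (suc (2 * d)) ≡ just α → take (2 * suc (suc d)) κ ≡ ρ ++ β ∷ φ ∷ [] →
    take (2 * suc d) κ ≡ ρ × at κ (suc (2 * d)) ≡ just α × at κ (suc (suc (2 * d))) ≡ just β
  key-shrink {d} {κ} {ρ} {β = β} |ρ| at-α tk
    with subst (λ n → take n κ ≡ ρ × at κ n ≡ just β) |ρ| (take≡++∷⇒ ρ tk)
  ... | tk′ , at-β =
    tk′ , trans (sym (at-prefix tk′ (odd<double (n<1+n d)))) at-α , trans (cong (at κ) (sym (*-suc 2 d))) at-β

  key-extend : {r : Rule} {u d : ℕ} {κ ρ : List Φ} {β : Φ} → InAngle r u κ → suc d < u →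
    take (2 * suc d) κ ≡ ρ → at κ (suc (suc (2 * d))) ≡ just β →
    ∃ λ φ → f r (suc (suc d)) (ρ ++ β ∷ []) ≡ just φ × take (2 * suc (suc d)) κ ≡ ρ ++ β ∷ φ ∷ []
  key-extend {r} {u} {d} {κ} {ρ} {β} (_ , angle) sd<u tk at-β with angle (suc d) sd<u
  ... | φ , at-φ , fφ = φ , subst (λ ys → f r (suc (suc d)) ys ≡ just φ) tk-β fφ , tk-βφ
    where
    open ≡-Reasoning
    tk-β : take (suc (2 * suc d)) κ ≡ ρ ++ β ∷ []
    tk-β = take-suc-at tk (trans (cong (at κ) (*-suc 2 d)) at-β)
    tk-βφ : take (2 * suc (suc d)) κ ≡ ρ ++ β ∷ φ ∷ []
    tk-βφ = begin
      take (2 * suc (suc d)) κ           ≡⟨ cong (λ n → take n κ) (*-suc 2 (suc d)) ⟩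
      take (suc (suc (2 * suc d))) κ     ≡⟨ take-suc-at tk-β at-φ ⟩
      (ρ ++ β ∷ []) ++ φ ∷ []            ≡⟨ ++-assoc ρ (β ∷ []) (φ ∷ []) ⟩
      ρ ++ β ∷ φ ∷ []                    ∎

  TyI-params-bound : {r : Rule} {α β : Φ} {mid : List Φ} {d : ℕ} →
    InAngle r (suc (length (rhs r))) (α ∷ mid ++ β ∷ []) → d < length (rhs r) → suc (2 * d) < length mid
  TyI-params-bound {r} {α} {β} {mid} {d} (|κ| , _) d<n =
    subst (suc (2 * d) <_) (sym |mid|) (odd<double d<n)
    where
    |mid| : length mid ≡ 2 * length (rhs r)
    |mid| = suc-injective (suc-injective (begin
      suc (suc (length mid))              ≡⟨ cong suc (sym (length-∷ʳ mid)) ⟩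
      length (α ∷ mid ++ β ∷ [])          ≡⟨ |κ| ⟩
      2 * suc (length (rhs r))            ≡⟨ *-suc 2 (length (rhs r)) ⟩
      suc (suc (2 * length (rhs r)))      ∎))
      where open ≡-Reasoning

  TyII-params-bound : {r : Rule} {h : ℕ} {α : Φ} {mid : List Φ} {d : ℕ} →
    InAngle r h (α ∷ mid) → suc d < h → suc (2 * d) < length mid
  TyII-params-bound {d = d} (|κ| , _) sd<h =
    <-trans (odd<double (n<1+n d)) (s≤s⁻¹ (subst (suc (2 * suc d) <_) (sym |κ|) (odd<double sd<h)))

  TyII-length : {r : Rule} {h : ℕ} {α βh : Φ} {mid : List Φ} →
    h ≤ length (rhs r) → InAngle r h (α ∷ mid) → length (liftRhs (take h (rhs r)) (mid ++ βh ∷ [])) ≡ h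
  TyII-length {r} {h} {mid = mid} h≤n (|κ| , _) =
    trans (length-liftRhs (take h (rhs r)) (mid ++ _ ∷ []) (trans (length-∷ʳ mid) (trans |κ| (cong (2 *_) (sym |Xs|)))))
          |Xs|
    where
    |Xs| : length (take h (rhs r)) ≡ h
    |Xs| = trans (length-take h (rhs r)) (m≤n⇒m⊓n≡m h≤n)

  -- w has s right after its first d symbols, and what follows s is not just ⊥ (so scanning s survives Norm).
  ScansAt : List Symbar → ℕ → Symbar → Set
  ScansAt w d s = ∃₂ λ pre post → w ≡ pre ++ s ∷ post × length pre ≡ d × post ≢ inj₁ bot ∷ []

  instance-scan⁻ : {r : Rule} {d : ℕ} {ρ : List Φ} {t : 𝔗} {α β φ : Φ} {L : NTbar} {w : List Symbar} →
    length ρ ≡ 2 * suc d → at (rhs r) d ≡ just (inj₂ t) → at ρ (suc (2 * d)) ≡ just α →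
    Instance r (suc d) (ρ ++ β ∷ φ ∷ []) L w →
    Instance r d ρ L w × ScansAt w d (inj₂ (t , α , β))
  instance-scan⁻ {r} {d} |ρ| at-X at-α (inj₁ (α₀ , mid , β₀ , tyI@(angle , _ , w≡) , tk))
    with key-shrink |ρ| at-α tk
  ... | tk′ , at-α′ , at-β′
    with bound ← TyI-params-bound angle (at-just⇒< (rhs r) d at-X)
    with split-liftRhs (rhs r) mid d at-X (trans (sym (at-++ˡ mid (<-trans (n<1+n _) bound))) at-α′)
                                           (trans (sym (at-++ˡ mid bound)) at-β′)
  ... | pre , post , lift≡ , |pre| =
    inj₁ (α₀ , mid , β₀ , tyI , tk′) , pre , post , trans w≡ lift≡ , |pre| , post≢⊥
    where
    post≢⊥ : post ≢ inj₁ bot ∷ []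
    post≢⊥ refl = ⊥∉liftRhs (rhs r) mid (pre ++ _ ∷ []) (trans lift≡ (sym (++-assoc pre (_ ∷ []) _)))
  instance-scan⁻ {r} {d} |ρ| at-X at-α
    (inj₂ (h , α₀ , mid , βh , β₀ , tyII@(_ , h≤n , angle , _ , _ , w≡) , sd<h , tk))
    with key-shrink |ρ| at-α tk
  ... | tk′ , at-α′ , at-β′
    with split-liftRhs (take h (rhs r)) (mid ++ βh ∷ []) d (trans (at-take (rhs r) (<⇒≤ sd<h)) at-X)
                       (at-++-just mid at-α′) (at-++-just mid at-β′)
  ... | pre , post , lift≡ , |pre| =
    inj₂ (h , α₀ , mid , βh , β₀ , tyII , <⇒≤ sd<h , tk′) ,
    pre , post ++ inj₁ bot ∷ [] , trans w≡ (trans (cong (_++ inj₁ bot ∷ []) lift≡) (++-assoc pre _ _)) ,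
    |pre| , post⊥≢⊥
    where
    post⊥≢⊥ : post ++ inj₁ bot ∷ [] ≢ inj₁ bot ∷ []
    post⊥≢⊥ e with refl ← ∷ʳ-injectiveˡ post [] e = <-irrefl (trans (sym |lift|) (TyII-length h≤n angle)) sd<h
      where
      |lift| : length (liftRhs (take h (rhs r)) (mid ++ βh ∷ [])) ≡ suc d
      |lift| = trans (cong length lift≡) (trans (length-∷ʳ pre) (cong suc |pre|))

  instance-scan⁺ : {r : Rule} {ρ : List Φ} {t : 𝔗} {α β : Φ} {L : NTbar}
    (a : List Symbar) {b : List Symbar} →
    let d = length a ; w = a ++ inj₂ (t , α , β) ∷ b in
    Instance r d ρ L w → b ≢ inj₁ bot ∷ [] →
    ∃ λ φ → at (rhs r) d ≡ just (inj₂ t) × at ρ (suc (2 * d)) ≡ just α ×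
      f r (suc (suc d)) (ρ ++ β ∷ []) ≡ just φ × Instance r (suc d) (ρ ++ β ∷ φ ∷ []) L w
  instance-scan⁺ {r} a (inj₁ (α₀ , mid , β₀ , tyI@(angle , _ , w≡) , tk)) _
    with lookup-liftRhs (rhs r) mid a (sym w≡)
  ... | X , _ , _ , at-X , at-α , at-β , s≡
    with refl , refl , refl ← liftSym-terminal X s≡
    with key-extend angle (s≤s (at-just⇒< (rhs r) (length a) at-X)) tk (at-++-just mid at-β)
  ... | φ , fφ , tk′ =
    φ , at-X , trans (at-prefix tk (odd<double (n<1+n (length a)))) (at-++-just mid at-α) , fφ ,
    inj₁ (α₀ , mid , β₀ , tyI , tk′)
  instance-scan⁺ {r} a {b} (inj₂ (h , α₀ , mid , βh , β₀ , tyII@(_ , h≤n , angle , _ , _ , w≡) , d<h , tk))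
    b≢⊥
    with ++-∷-split (liftRhs (take h (rhs r)) (mid ++ βh ∷ [])) (inj₁ bot ∷ []) a (sym w≡)
                    (subst (length a <_) (sym (TyII-length h≤n angle)) d<h)
  ... | [] , _ , b≡ = ⊥-elim (b≢⊥ b≡)
  ... | s′ ∷ b′ , lift≡ , _
    with sd<h ← subst (suc (length a) <_) (trans (cong length (sym lift≡)) (TyII-length h≤n angle))
                      (length-++-∷-∷ a)
    with bound ← TyII-params-bound angle sd<h
    with lookup-liftRhs (take h (rhs r)) (mid ++ βh ∷ []) a lift≡
  ... | X , _ , _ , at-X , at-α , at-β , s≡
    with refl , refl , refl ← liftSym-terminal X s≡
    with key-extend angle sd<h tk (trans (sym (at-++ˡ mid bound)) at-β)
  ... | φ , fφ , tk′ =
    φ , trans (sym (at-take (rhs r) d<h)) at-X ,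
    trans (at-prefix tk (odd<double (n<1+n (length a))))
          (trans (sym (at-++ˡ mid (<-trans (n<1+n _) bound))) at-α) ,
    fφ , inj₂ (h , α₀ , mid , βh , β₀ , tyII , sd<h , tk′)

  module _ (ℜ : Rule → Set) (𝔖 : 𝔑) (φstart : Φ) (D : List Σ) where
    open Lexing ℜ 𝔖 φstart D

    module _ {k : ℕ} {T : PToken → Set} {I : PItem → Set} {I' : OItem → Set} (I∼I' : I ∼ I') where

      Bar-Scan⊆Norm-Scan' : ((x : PItem) → I x → ValidPItem x) →
        (y : OItem) → BarSet (Scan T k I) y → Norm (Scan' (𝒰 T) k I') y
      Bar-Scan⊆Norm-Scan' _ y (x , inj₁ Ix , x̄y) = map₁ inj₁ (proj₁ (I∼I' y) (x , Ix , x̄y))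
      Bar-Scan⊆Norm-Scan' valid (oitem L w _ _ _)
        (_ , inj₂ (r , d , i , ρ , t , α , β , c , φ , Ix , _ , at-X , at-α , Tt , _ , refl) ,
         refl , refl , refl , inst)
        with _ , _ , _ , _ , |ρ| , _ ← valid _ Ix
        with instance-scan⁻ |ρ| at-X at-α inst
      ... | inst₀ , pre , post , refl , refl , post≢⊥
        with I'y₀ , L≢⊤ , _ ← proj₁ (I∼I' _) (pitem r (length pre) i k ρ , Ix , refl , refl , refl , inst₀) =
        inj₂ (L , pre , (t , α , β) , post , i , c , I'y₀ , (ptok t α β c , Tt , refl , refl) , refl) ,
        L≢⊤ , post≢⊥ ∘ trans (sym (drop-++-∷ pre))

      Norm-Scan'⊆Bar-Scan : (y : OItem) → Norm (Scan' (𝒰 T) k I') y → BarSet (Scan T k I) y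
      Norm-Scan'⊆Bar-Scan y (inj₁ I'y , L≢⊤ , ¬⊥)
        with x , Ix , x̄y ← proj₂ (I∼I' y) (I'y , L≢⊤ , ¬⊥) = x , inj₁ Ix , x̄y
      Norm-Scan'⊆Bar-Scan _
        (inj₂ (L , a , _ , b , i , c , I'y₀ , (ptok t α β _ , Tt , refl , refl) , refl) , L≢⊤ , ¬⊥)
        with proj₂ (I∼I' (oitem L (a ++ inj₂ (t , α , β) ∷ b) (length a) i k)) (I'y₀ , L≢⊤ , scannable)
        where
        scannable : drop (length a) (a ++ inj₂ (t , α , β) ∷ b) ≢ inj₁ bot ∷ []
        scannable e with () ← ∷-injectiveˡ (trans (sym (drop-++-length a)) e)
      ... | pitem r _ _ _ ρ , Ix , refl , refl , refl , inst
        with φ , at-X , at-α , fφ , inst′ ← instance-scan⁺ a inst (¬⊥ ∘ trans (drop-++-∷ a)) =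
        pitem r (suc (length a)) i (k + length c) (ρ ++ β ∷ φ ∷ []) ,
        inj₂ (r , length a , i , ρ , t , α , β , c , φ , Ix , at-just⇒< (rhs r) (length a) at-X ,
              at-X , at-α , Tt , fφ , refl) ,
        refl , refl , refl , inst′

theorem9 : (Φ 𝔑 𝔗 Σ : Set) →
    let open Grammar Φ 𝔑 𝔗 Σ in
    (ℜ : Rule → Set) (𝔖 : 𝔑) (φstart : Φ) (D : List Σ) →
    let open Lexing ℜ 𝔖 φstart D in
    (k : ℕ) → k ≤ length D →
    (T : PToken → Set) → ((tk : PToken) → T tk → k + length (chars tk) ≤ length D) →
    (I : PItem → Set) → ((x : PItem) → I x → ValidPItem x) →
    (I' : OItem → Set) → ((y : OItem) → I' y → ValidOItem y) →
    I ∼ I' →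
    Scan T k I ∼ Scan' (𝒰 T) k I'
theorem9 Φ 𝔑 𝔗 Σ ℜ 𝔖 φstart D k _ T _ I valid I' _ I∼I' y =
  Bar-Scan⊆Norm-Scan' Φ 𝔑 𝔗 Σ ℜ 𝔖 φstart D I∼I' valid y ,
  Norm-Scan'⊆Bar-Scan Φ 𝔑 𝔗 Σ ℜ 𝔖 φstart D I∼I' y
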